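{- Let $a,b$ be positive integers and $k\le a+b$. There is at most one culminating walk with steps $+a,-b$ whose final height is $k$.
   Context: A walk of length $n$ with steps $+a,-b$ is a sequence of heights $\eta_0=0,\eta_1,\dots,\eta_n$ with $\eta_{i+1}-\eta_i\in\{a,-b\}$. It is culminating if $\eta_i>0$ for all $1\le i\le n$ and $\eta_i<\eta_n$ for all $0\le i\le n-1$; its final height is $\eta_n$. Throughout, $a$ and $b$ are assumed coprime. -}

module Defs where

open import Data.Nat using (ℕ; zero; suc)
open import Data.Fin using (Fin; toℕ; inject₁; fromℕ)
open import Data.Vec using (Vec; []; _∷_; lookup)
open import Data.Integer using (ℤ; +_; _+_; _-_; _<_)

data Step : Set where
  up down : Step

stepValue : ℕ → ℕ → Step → ℤ
stepValue a b up   = + a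
stepValue a b down = Data.Integer.- (+ b)

heights : (a b : ℕ) {n : ℕ} → Vec Step n → Vec ℤ (suc n)
heights a b []       = + 0 ∷ []
heights a b (s ∷ ss) = + 0 ∷ Data.Vec.map (λ h → stepValue a b s + h) (heights a b ss)

height : (a b : ℕ) {n : ℕ} → Vec Step n → Fin (suc n) → ℤ
height a b w i = lookup (heights a b w) i

finalHeight : (a b : ℕ) {n : ℕ} → Vec Step n → ℤ
finalHeight a b {n} w = height a b w (fromℕ n)

-- culminating: η_i > 0 for 1 ≤ i ≤ n, and η_i < ηₙ for 0 ≤ i ≤ n-1
record Culminating (a b : ℕ) {n : ℕ} (w : Vec Step n) : Set where
  field
    positive : (i : Fin n) → + 0 < height a b w (Data.Fin.suc i)
    belowEnd : (i : Fin n) → height a b w (inject₁ i) < finalHeight a b w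

-- Two culminating walks with the same final height k agree on their common
-- prefix, so after it they stand at a common height c and are both walks that
-- culminate at k from c.  Neither can have ended there, because a walk that has
-- not ended is still strictly below its final height.  Nor can their next steps
-- differ: the down step needs c - b > 0 and the up step needs c + a ≤ k, while
-- k ≤ a + b.
module Submission where

open import Defs
open import Data.Nat using (ℕ; suc)
open import Data.Nat.Coprimality using (Coprime)
open import Data.Integer using (ℤ; +_; _+_; _-_; _≤_; _<_)
open import Data.Integer.Properties
  using (+-assoc; +-identityˡ; +-identityʳ; +-monoˡ-<; <-irrefl; <⇒≤; ≤-reflexive; module ≤-Reasoning)
open import Data.Integer.Tactic.RingSolver using (solve-∀)
open import Data.Fin using (Fin; zero; suc; inject₁; fromℕ)
open import Data.Vec using (Vec; []; _∷_)
open import Data.Vec.Properties using (lookup-map)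
open import Data.Product using (Σ; _,_)
open import Data.Empty using (⊥; ⊥-elim)
open import Relation.Binary.PropositionalEquality
  using (_≡_; refl; sym; trans; cong; subst; module ≡-Reasoning)

no-room-for-up-and-down : ∀ a b c {k : ℤ} → k ≤ a + b → + 0 < c - b → c + a ≤ k → ⊥
no-room-for-up-and-down a b c {k} k≤a+b 0<c-b c+a≤k = <-irrefl refl (begin-strict
  a + b               ≡⟨ sym (+-identityˡ (a + b)) ⟩
  + 0 + (a + b)       <⟨ +-monoˡ-< (a + b) 0<c-b ⟩
  (c - b) + (a + b)   ≡⟨ cancel c a b ⟩
  c + a               ≤⟨ c+a≤k ⟩
  k                   ≤⟨ k≤a+b ⟩
  a + b               ∎)
  where
  open ≤-Reasoning
  cancel : ∀ c a b → (c - b) + (a + b) ≡ c + a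
  cancel = solve-∀

cons-cong : ∀ s {n m} {v : Vec Step n} {w : Vec Step m} →
            _≡_ {A = Σ ℕ (Vec Step)} (n , v) (m , w) →
            _≡_ {A = Σ ℕ (Vec Step)} (suc n , s ∷ v) (suc m , s ∷ w)
cons-cong s refl = refl

module _ {a b : ℕ} where

  height-zero : ∀ {n} (w : Vec Step n) → height a b w zero ≡ + 0
  height-zero []      = refl
  height-zero (_ ∷ _) = refl

  height-suc : ∀ s {n} (w : Vec Step n) i →
               height a b (s ∷ w) (suc i) ≡ stepValue a b s + height a b w i
  height-suc s w i = lookup-map i (λ h → stepValue a b s + h) (heights a b w)

  shifted-height-suc : ∀ c s {n} (w : Vec Step n) i →
                       c + height a b (s ∷ w) (suc i) ≡ (c + stepValue a b s) + height a b w i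
  shifted-height-suc c s w i = begin
    c + height a b (s ∷ w) (suc i)           ≡⟨ cong (_+_ c) (height-suc s w i) ⟩
    c + (stepValue a b s + height a b w i)   ≡⟨ sym (+-assoc c (stepValue a b s) _) ⟩
    (c + stepValue a b s) + height a b w i   ∎
    where open ≡-Reasoning

  record CulminatingFrom (c k : ℤ) {n : ℕ} (w : Vec Step n) : Set where
    field
      positive : (i : Fin n) → + 0 < c + height a b w (suc i)
      belowEnd : (i : Fin n) → c + height a b w (inject₁ i) < k
      endsAt   : c + finalHeight a b w ≡ k

  open CulminatingFrom

  culminating⇒culminatingFrom0 : ∀ {k n} {w : Vec Step n} →
    Culminating a b w → finalHeight a b w ≡ k → CulminatingFrom (+ 0) k w
  culminating⇒culminatingFrom0 {k} {w = w} C refl = record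
    { positive = λ i → subst (+ 0 <_) (sym (+-identityˡ _)) (Culminating.positive C i)
    ; belowEnd = λ i → subst (_< k) (sym (+-identityˡ _)) (Culminating.belowEnd C i)
    ; endsAt   = +-identityˡ k
    }

  culminatingFrom-tail : ∀ {c k s n} {w : Vec Step n} →
    CulminatingFrom c k (s ∷ w) → CulminatingFrom (c + stepValue a b s) k w
  culminatingFrom-tail {c} {k} {s} {w = w} C = record
    { positive = λ i → subst (+ 0 <_) (shifted-height-suc c s w (suc i)) (positive C (suc i))
    ; belowEnd = λ i → subst (_< k) (shifted-height-suc c s w (inject₁ i)) (belowEnd C (suc i))
    ; endsAt   = trans (sym (shifted-height-suc c s w (fromℕ _))) (endsAt C)
    }

  start≡end : ∀ {c k} → CulminatingFrom c k [] → c ≡ k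
  start≡end {c} C = trans (sym (+-identityʳ c)) (endsAt C)

  start<end : ∀ {c k s n} {w : Vec Step n} → CulminatingFrom c k (s ∷ w) → c < k
  start<end {c} C = subst (_< _) (+-identityʳ c) (belowEnd C zero)

  start≤end : ∀ {c k n} {w : Vec Step n} → CulminatingFrom c k w → c ≤ k
  start≤end {w = []}    C = ≤-reflexive (start≡end C)
  start≤end {w = _ ∷ _} C = <⇒≤ (start<end C)

  first-step-positive : ∀ {c k s n} {w : Vec Step n} →
    CulminatingFrom c k (s ∷ w) → + 0 < c + stepValue a b s
  first-step-positive {c} {s = s} {w = w} C = subst (+ 0 <_) first-height (positive C zero)
    where
    first-height : c + height a b (s ∷ w) (suc zero) ≡ c + stepValue a b s
    first-height = trans (shifted-height-suc c s w zero)
                         (trans (cong (λ h → c + stepValue a b s + h) (height-zero w)) (+-identityʳ _))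

  up-down-exclusive : ∀ {c k n m} → k ≤ + a + + b → {v : Vec Step n} {w : Vec Step m} →
    CulminatingFrom c k (up ∷ v) → CulminatingFrom c k (down ∷ w) → ⊥
  up-down-exclusive {c} k≤a+b U D =
    no-room-for-up-and-down (+ a) (+ b) c k≤a+b (first-step-positive D) (start≤end (culminatingFrom-tail U))

  culminatingFrom-unique : ∀ {c k n m} → k ≤ + a + + b → (v : Vec Step n) (w : Vec Step m) →
    CulminatingFrom c k v → CulminatingFrom c k w → _≡_ {A = Σ ℕ (Vec Step)} (n , v) (m , w)
  culminatingFrom-unique k≤a+b []         []         _ _ = refl
  culminatingFrom-unique k≤a+b []         (_ ∷ _)    V W = ⊥-elim (<-irrefl (start≡end V) (start<end W))
  culminatingFrom-unique k≤a+b (_ ∷ _)    []         V W = ⊥-elim (<-irrefl (start≡end W) (start<end V))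
  culminatingFrom-unique k≤a+b (up ∷ v)   (down ∷ w) V W = ⊥-elim (up-down-exclusive k≤a+b V W)
  culminatingFrom-unique k≤a+b (down ∷ v) (up ∷ w)   V W = ⊥-elim (up-down-exclusive k≤a+b W V)
  culminatingFrom-unique k≤a+b (up ∷ v)   (up ∷ w)   V W =
    cons-cong up (culminatingFrom-unique k≤a+b v w (culminatingFrom-tail V) (culminatingFrom-tail W))
  culminatingFrom-unique k≤a+b (down ∷ v) (down ∷ w) V W =
    cons-cong down (culminatingFrom-unique k≤a+b v w (culminatingFrom-tail V) (culminatingFrom-tail W))

mainTheorem4 : (a b : ℕ) → 1 Data.Nat.≤ a → 1 Data.Nat.≤ b → Coprime a b →
    (k : ℤ) → k ≤ + a + + b →
    (n m : ℕ) (v : Vec Step n) (w : Vec Step m) →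
    Culminating a b v → Culminating a b w →
    finalHeight a b v ≡ k → finalHeight a b w ≡ k →
    _≡_ {A = Σ ℕ (Vec Step)} (n , v) (m , w)
mainTheorem4 a b _ _ _ k k≤a+b _ _ v w Cv Cw ev ew =
  culminatingFrom-unique k≤a+b v w
    (culminating⇒culminatingFrom0 Cv ev) (culminating⇒culminatingFrom0 Cw ew)
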